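{- There are no formulas $C(x,y,z)$ and $D(x,y)$ (with exactly the displayed free variables) such that all of the following hold: (1) $\mathbb N\models\forall x\forall y\exists z\,C(x,y,z)$; (2) $\mathbb N\models\forall x\forall u\forall v\forall z\,(C(x,u,z)\land C(x,v,z)\to u=v)$; (3) $\mathbb N\models\forall x\forall y\forall z\,(C(x,y,z)\to D(z,x))$; (4) $\mathbf{BA}\vdash\top\Rightarrow\exists y\,D(x,y)$; (5) $\mathbf{BA}\vdash D(x,u)\land D(x,v)\Rightarrow u=v$.
   Context: Basic Arithmetic $\mathbf{BA}$ (Ruitenburg) is the following theory of sequents $A\Rightarrow B$ in the language $\{0,S,+,\cdot\}$, where formulas are built from atomic formulas ($s=t$, $\top$, $\bot$) by $\land,\lor,\exists x$ and the former $\forall\mathbf x(A\to B)$ ($\mathbf x$ a finite, possibly empty, sequence of variables; empty gives $A\to B$). Logical part (Basic Predicate Calculus): axioms $A\Rightarrow A$; $A\Rightarrow\top$; $\bot\Rightarrow A$; $A\land(B\lor C)\Rightarrow(A\land B)\lor(A\land C)$; $A\land\exists xB\Rightarrow\exists x(A\land B)$ ($x$ not free in $A$); $\top\Rightarrow x=x$; $x=y\land A\Rightarrow A[x/y]$ ($A$ atomic); $\forall\mathbf x(A\to B)\land\forall\mathbf x(B\to C)\Rightarrow\forall\mathbf x(A\to C)$; $\forall\mathbf x(A\to B)\land\forall\mathbf x(A\to C)\Rightarrow\forall\mathbf x(A\to B\land C)$; $\forall\mathbf x(B\to A)\land\forall\mathbf x(C\to A)\Rightarrow\forall\mathbf x(B\lor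 C\to A)$; $\forall\mathbf x(A\to B)\Rightarrow\forall\mathbf x(A[\mathbf x/\mathbf t]\to B[\mathbf x/\mathbf t])$; $\forall\mathbf x(A\to B)\Rightarrow\forall\mathbf y(A\to B)$ (no variable of $\mathbf y$ free on the left); $\forall\mathbf yx(B\to A)\Rightarrow\forall\mathbf y(\exists xB\to A)$ ($x$ not free in $A$); rules: transitivity; $A\Rightarrow B\land C$ iff $A\Rightarrow B$ and $A\Rightarrow C$; $B\lor C\Rightarrow A$ iff $B\Rightarrow A$ and $C\Rightarrow A$; term substitution; $\exists xB\Rightarrow A$ iff $B\Rightarrow A$ ($x$ not free in $A$); from $A\land B\Rightarrow C$ infer $A\Rightarrow\forall\mathbf x(B\to C)$ (no variable of $\mathbf x$ free in $A$). Arithmetic part: $Sx=0\Rightarrow\bot$; $Sx=Sy\Rightarrow x=y$; $x+0=x$; $x+Sy=S(x+y)$; $x\cdot0=0$; $x\cdot Sy=x\cdot y+x$; induction axiom schema $\forall\mathbf yx(A\to A[x/Sx])\Rightarrow\forall\mathbf yx(A[x/0]\to A)$; induction rule: from $A\Rightarrow A[x/Sx]$ infer $A[x/0]\Rightarrow A$. "$\mathbf{BA}\vdash A$" means $\mathbf{BA}\vdash\top\Rightarrow A$. In clauses (1)–(3), formulas are evaluated classically in the standard model $\mathbb N$ (with $\forall\mathbf x(A\to B)$ read classically). -}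

module Defs where

open import Data.Nat using (ℕ; zero; suc; _+_; _*_)
open import Data.Fin using (Fin; zero; suc; splitAt; _↑ˡ_; _↑ʳ_; _≟_)
open import Data.Sum using (_⊎_; inj₁; inj₂; [_,_])
open import Data.Product using (Σ; _×_; _,_)
open import Data.Unit using (⊤)
open import Data.Empty using (⊥)
open import Relation.Nullary using (¬_; yes; no)
open import Relation.Binary.PropositionalEquality using (_≡_)

data Term (n : ℕ) : Set where
  var  : Fin n → Term n
  𝟎    : Term n
  S    : Term n → Term n
  _⊕_  : Term n → Term n → Term n
  _⊗_  : Term n → Term n → Term n

-- Formulas: atoms s = t, ⊤, ⊥; ∧, ∨, ∃x; and the former ∀x(A → B)
-- binding a finite sequence of k variables (k = 0 gives A → B).
-- In  ∀' k A B  the bound variables are the indices 0 … k-1 of Fin (k + n);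
-- the free variable j of the outer context is  k ↑ʳ j.
-- In  ∃' A  the bound variable is index 0.
data Formula (n : ℕ) : Set where
  _≐_  : Term n → Term n → Formula n
  ⊤'   : Formula n
  ⊥'   : Formula n
  _∧'_ : Formula n → Formula n → Formula n
  _∨'_ : Formula n → Formula n → Formula n
  ∃'   : Formula (suc n) → Formula n
  ∀'   : (k : ℕ) → Formula (k + n) → Formula (k + n) → Formula n

Sub : ℕ → ℕ → Set
Sub n m = Fin n → Term m

renT : ∀ {n m} → (Fin n → Fin m) → Term n → Term m
renT ρ (var i) = var (ρ i)
renT ρ 𝟎 = 𝟎
renT ρ (S t) = S (renT ρ t)
renT ρ (s ⊕ t) = renT ρ s ⊕ renT ρ t
renT ρ (s ⊗ t) = renT ρ s ⊗ renT ρ t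

subT : ∀ {n m} → Sub n m → Term n → Term m
subT σ (var i) = σ i
subT σ 𝟎 = 𝟎
subT σ (S t) = S (subT σ t)
subT σ (s ⊕ t) = subT σ s ⊕ subT σ t
subT σ (s ⊗ t) = subT σ s ⊗ subT σ t

liftˢ : ∀ {n m} k → Sub n m → Sub (k + n) (k + m)
liftˢ {n} {m} k σ i = [ (λ b → var (b ↑ˡ m)) , (λ j → renT (k ↑ʳ_) (σ j)) ] (splitAt k i)

sub : ∀ {n m} → Sub n m → Formula n → Formula m
sub σ (s ≐ t) = subT σ s ≐ subT σ t
sub σ ⊤' = ⊤'
sub σ ⊥' = ⊥'
sub σ (A ∧' B) = sub σ A ∧' sub σ B
sub σ (A ∨' B) = sub σ A ∨' sub σ B
sub σ (∃' A) = ∃' (sub (liftˢ 1 σ) A)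
sub σ (∀' k A B) = ∀' k (sub (liftˢ k σ) A) (sub (liftˢ k σ) B)

ren : ∀ {n m} → (Fin n → Fin m) → Formula n → Formula m
ren ρ = sub (λ i → var (ρ i))

wk : ∀ {n} → Formula n → Formula (suc n)
wk = ren suc

wkk : ∀ {n} k → Formula n → Formula (k + n)
wkk k = ren (k ↑ʳ_)

single : ∀ {n} → Fin n → Term n → Sub n n
single x t i with x ≟ i
... | yes _ = t
... | no _  = var i

instSub : ∀ {n} k → (Fin k → Term (k + n)) → Sub (k + n) (k + n)
instSub k ts i = [ ts , (λ j → var (k ↑ʳ j)) ] (splitAt k i)

succ₀ : ∀ {n} → Sub (suc n) (suc n)
succ₀ zero = S (var zero)
succ₀ (suc i) = var (suc i)

zero₀ : ∀ {n} → Sub (suc n) (suc n)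
zero₀ zero = 𝟎
zero₀ (suc i) = var (suc i)

occT : ∀ {n} → Fin n → Term n → Set
occT i (var j) = i ≡ j
occT i 𝟎 = ⊥
occT i (S t) = occT i t
occT i (s ⊕ t) = occT i s ⊎ occT i t
occT i (s ⊗ t) = occT i s ⊎ occT i t

occ : ∀ {n} → Fin n → Formula n → Set
occ i (s ≐ t) = occT i s ⊎ occT i t
occ i ⊤' = ⊥
occ i ⊥' = ⊥
occ i (A ∧' B) = occ i A ⊎ occ i B
occ i (A ∨' B) = occ i A ⊎ occ i B
occ i (∃' A) = occ (suc i) A
occ {n} i (∀' k A B) = occ (k ↑ʳ i) A ⊎ occ (k ↑ʳ i) B

data Atomic {n : ℕ} : Formula n → Set where
  at-eq : ∀ s t → Atomic (s ≐ t)
  at-⊤  : Atomic ⊤'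
  at-⊥  : Atomic ⊥'

infix 4 BA⊢_⇒_

private variable n m : ℕ


data BA⊢_⇒_ : {n : ℕ} → Formula n → Formula n → Set where
  ax-id    : ∀ {A : Formula n} → BA⊢ A ⇒ A
  ax-⊤     : ∀ {A : Formula n} → BA⊢ A ⇒ ⊤'
  ax-⊥     : ∀ {A : Formula n} → BA⊢ ⊥' ⇒ A
  ax-dist  : ∀ {A B C : Formula n} → BA⊢ A ∧' (B ∨' C) ⇒ (A ∧' B) ∨' (A ∧' C)
  ax-frob  : ∀ {A : Formula n} {B : Formula (suc n)} → BA⊢ A ∧' ∃' B ⇒ ∃' (wk A ∧' B)
  ax-refl  : ∀ (x : Fin n) → BA⊢ ⊤' ⇒ (var x ≐ var x)
  ax-eq    : ∀ (x y : Fin n) {A} → Atomic A →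
             BA⊢ (var x ≐ var y) ∧' A ⇒ sub (single x (var y)) A
  ax-trans : ∀ {k} {A B C : Formula (k + n)} → BA⊢ ∀' k A B ∧' ∀' k B C ⇒ ∀' k A C
  ax-conj  : ∀ {k} {A B C : Formula (k + n)} → BA⊢ ∀' k A B ∧' ∀' k A C ⇒ ∀' k A (B ∧' C)
  ax-disj  : ∀ {k} {A B C : Formula (k + n)} → BA⊢ ∀' k B A ∧' ∀' k C A ⇒ ∀' k (B ∨' C) A
  ax-inst  : ∀ {k} {A B : Formula (k + n)} (ts : Fin k → Term (k + n)) →
             BA⊢ ∀' k A B ⇒ ∀' k (sub (instSub k ts) A) (sub (instSub k ts) B)
  -- ∀x(A → B) ⇒ ∀y(A → B), no variable of y free on the left:
  -- ρ maps every variable occurring in A, B to its position on the right,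
  -- keeps the free variables of the left free (unchanged), and is
  -- injective on the occurring variables (so names stay distinct).
  ax-rebind : ∀ {k m} {A B : Formula (k + n)} (ρ : Fin (k + n) → Fin (m + n)) →
             (∀ j → occ j (∀' k A B) → ρ (k ↑ʳ j) ≡ m ↑ʳ j) →
             (∀ a b → occ a A ⊎ occ a B → occ b A ⊎ occ b B → ρ a ≡ ρ b → a ≡ b) →
             BA⊢ ∀' k A B ⇒ ∀' m (ren ρ A) (ren ρ B)
  ax-∃     : ∀ {k} {B : Formula (suc k + n)} {A : Formula (k + n)} → BA⊢ ∀' (suc k) B (wk A) ⇒ ∀' k (∃' B) A
  r-trans  : ∀ {A B C : Formula n} → BA⊢ A ⇒ B → BA⊢ B ⇒ C → BA⊢ A ⇒ C
  r-∧I     : ∀ {A B C : Formula n} → BA⊢ A ⇒ B → BA⊢ A ⇒ C → BA⊢ A ⇒ B ∧' C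
  r-∧E₁    : ∀ {A B C : Formula n} → BA⊢ A ⇒ B ∧' C → BA⊢ A ⇒ B
  r-∧E₂    : ∀ {A B C : Formula n} → BA⊢ A ⇒ B ∧' C → BA⊢ A ⇒ C
  r-∨E     : ∀ {A B C : Formula n} → BA⊢ B ⇒ A → BA⊢ C ⇒ A → BA⊢ B ∨' C ⇒ A
  r-∨I₁    : ∀ {A B C : Formula n} → BA⊢ B ∨' C ⇒ A → BA⊢ B ⇒ A
  r-∨I₂    : ∀ {A B C : Formula n} → BA⊢ B ∨' C ⇒ A → BA⊢ C ⇒ A
  r-∃E     : ∀ {A : Formula n} {B : Formula (suc n)} → BA⊢ B ⇒ wk A → BA⊢ ∃' B ⇒ A
  r-∃I     : ∀ {A : Formula n} {B : Formula (suc n)} → BA⊢ ∃' B ⇒ A → BA⊢ B ⇒ wk A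
  r-→I     : ∀ {k} {A : Formula n} {B C : Formula (k + n)} → BA⊢ wkk k A ∧' B ⇒ C → BA⊢ A ⇒ ∀' k B C
  ar-S0    : ∀ (x : Fin n) → BA⊢ S (var x) ≐ 𝟎 ⇒ ⊥'
  ar-SS    : ∀ (x y : Fin n) → BA⊢ S (var x) ≐ S (var y) ⇒ var x ≐ var y
  ar-+0    : ∀ (x : Fin n) → BA⊢ ⊤' ⇒ (var x ⊕ 𝟎) ≐ var x
  ar-+S    : ∀ (x y : Fin n) → BA⊢ ⊤' ⇒ (var x ⊕ S (var y)) ≐ S (var x ⊕ var y)
  ar-·0    : ∀ (x : Fin n) → BA⊢ ⊤' ⇒ (var x ⊗ 𝟎) ≐ 𝟎
  ar-·S    : ∀ (x y : Fin n) → BA⊢ ⊤' ⇒ (var x ⊗ S (var y)) ≐ ((var x ⊗ var y) ⊕ var x)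
  ar-ind   : ∀ {k} (A : Formula (suc k + n)) →
             BA⊢ ∀' (suc k) A (sub succ₀ A) ⇒ ∀' (suc k) (sub zero₀ A) A
  r-subst  : ∀ {A B : Formula n} (σ : Sub n m) → BA⊢ A ⇒ B → BA⊢ sub σ A ⇒ sub σ B
  r-ind    : ∀ (x : Fin n) (A : Formula n) →
             BA⊢ A ⇒ sub (single x (S (var x))) A →
             BA⊢ sub (single x 𝟎) A ⇒ A

-- Since the metatheory is constructive, ∨ and ∃ are interpreted via the
-- Gödel–Gentzen negative translation (¬¬), so that ⟦ A ⟧ is the classical
-- truth value of A (all ⟦ A ⟧ ρ are ¬¬-stable; under excluded middle this
-- coincides with ordinary Tarskian truth).  ∀x(A → B) is read classically
-- as "for all values of x, A implies B".

Env : ℕ → Set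
Env n = Fin n → ℕ

extend : ∀ {k n} → (Fin k → ℕ) → Env n → Env (k + n)
extend {k} v ρ i = [ v , ρ ] (splitAt k i)

⟦_⟧ᵗ : ∀ {n} → Term n → Env n → ℕ
⟦ var i ⟧ᵗ ρ = ρ i
⟦ 𝟎 ⟧ᵗ ρ = 0
⟦ S t ⟧ᵗ ρ = suc (⟦ t ⟧ᵗ ρ)
⟦ s ⊕ t ⟧ᵗ ρ = ⟦ s ⟧ᵗ ρ + ⟦ t ⟧ᵗ ρ
⟦ s ⊗ t ⟧ᵗ ρ = ⟦ s ⟧ᵗ ρ * ⟦ t ⟧ᵗ ρ

⟦_⟧ : ∀ {n} → Formula n → Env n → Set
⟦ s ≐ t ⟧ ρ = ⟦ s ⟧ᵗ ρ ≡ ⟦ t ⟧ᵗ ρ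
⟦ ⊤' ⟧ ρ = ⊤
⟦ ⊥' ⟧ ρ = ⊥
⟦ A ∧' B ⟧ ρ = ⟦ A ⟧ ρ × ⟦ B ⟧ ρ
⟦ A ∨' B ⟧ ρ = ¬ ¬ (⟦ A ⟧ ρ ⊎ ⟦ B ⟧ ρ)
⟦ ∃' A ⟧ ρ = ¬ ¬ (Σ ℕ λ a → ⟦ A ⟧ (extend {1} (λ _ → a) ρ))
⟦ ∀' k A B ⟧ ρ = (v : Fin k → ℕ) → ⟦ A ⟧ (extend v ρ) → ⟦ B ⟧ (extend v ρ)

ℕ⊨_ : Formula 0 → Set
ℕ⊨ A = ⟦ A ⟧ (λ ())

-- Instantiating C(x,y,z) : Formula 3 and D(x,y) : Formula 2, whose free
-- variables x, y, z are Fin indices 0, 1, 2 respectively (in displayed order).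

_⟨_,_,_⟩ : ∀ {n} → Formula 3 → Term n → Term n → Term n → Formula n
C ⟨ r , s , t ⟩ = sub σ C
  where σ : Fin 3 → Term _
        σ zero = r
        σ (suc zero) = s
        σ (suc (suc zero)) = t

_⟨_,_⟩ : ∀ {n} → Formula 2 → Term n → Term n → Formula n
D ⟨ s , t ⟩ = sub σ D
  where σ : Fin 2 → Term _
        σ zero = s
        σ (suc zero) = t

BA⊢_ : ∀ {n} → Formula n → Set
BA⊢ A = BA⊢ ⊤' ⇒ A

-- Read formulas in ℕ∞ = ℕ ∪ {∞}, where ∞ absorbs S, + and · except that
-- 0 · ∞ = ∞ · 0 = 0, and read every former ∀x(A → B) as true. In the topology
-- making ∞ the limit of n → ∞, every formula then defines a closed set. This
-- makes BA sound in ℕ∞: the induction rule passes from all n to ∞ by closedness.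
-- By (1) and (2), for fixed x the relation C(x,·,·) sends distinct y to distinct
-- z, so by (3) D(z,x) holds for arbitrarily large z, and by closedness D(∞,x)
-- holds in ℕ∞. Then (5) yields 0 = 1 in ℕ∞.
module Submission where

open import Defs
open import Data.Fin using (#_)
open import Data.Product using (Σ; _×_)
open import Relation.Nullary using (¬_)
import Data.Product as Σ
open import Data.Nat using (ℕ; zero; suc; _+_; _*_; _≤_; _<_; _⊔_; z≤n; s≤s; _<?_)
open import Data.Nat.Properties
  using (m≤m⊔n; m≤n⊔m; ≤-trans; ≤-refl; ≮⇒≥; ≰⇒>; n≤1+n; n<1+n; m≤n⇒m<n∨m≡n; m≤m+n; m≤n+m; m≤m*n;
         +-comm; +-suc; +-identityʳ; *-suc; *-zeroʳ; <-irrefl)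
import Data.Nat as ℕ
open import Data.Fin using (Fin; zero; suc; splitAt; _↑ˡ_; _↑ʳ_; toℕ; fromℕ<; _≟_)
open import Data.Fin.Properties using (splitAt-↑ˡ; splitAt-↑ʳ; pigeonhole; fromℕ<-injective; toℕ-injective; <⇒≢)
open import Data.Vec.Functional using ([]; _∷_; head; tail)
open import Data.Sum using (_⊎_; inj₁; inj₂; [_,_])
open import Data.Product.Function.NonDependent.Propositional using (_×-⇔_)
open import Data.Product.Function.Dependent.Propositional using (Σ-⇔)
open import Data.Sum.Function.Propositional using (_⊎-⇔_)
open import Data.Unit using (⊤; tt)
open import Data.Empty using (⊥; ⊥-elim)
open import Function using (_∘_; id)
open import Function.Bundles using (_⇔_; mk⇔; Equivalence)
open import Function.Construct.Identity using (⇔-id; ↠-id)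
open import Function.Related.TypeIsomorphisms using (→-cong-⇔; ¬-cong-⇔)
open import Relation.Nullary using (Dec; yes; no; Stable)
open import Relation.Nullary.Negation using (¬¬-map; negated-stable)
open import Relation.Nullary.Decidable using (decidable-stable)
open import Relation.Binary.PropositionalEquality using (_≡_; refl; sym; trans; cong; cong₂; subst)

open Equivalence using (to; from)

-- Inside this block _,_ is in scope; at top level it would make C ⟨ r , s , t ⟩ ambiguous.
module _ where

  open import Data.Product using (_,_; proj₁; proj₂)

  private variable n m : ℕ

  ¬¬-cong-⇔ : {A B : Set} → A ⇔ B → (¬ ¬ A) ⇔ (¬ ¬ B)
  ¬¬-cong-⇔ = ¬-cong-⇔ ∘ ¬-cong-⇔

  Π-cong-⇔ : {A : Set} {P Q : A → Set} → (∀ a → P a ⇔ Q a) → ((a : A) → P a) ⇔ ((a : A) → Q a)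
  Π-cong-⇔ P⇔Q = mk⇔ (λ f a → to (P⇔Q a) (f a)) (λ g a → from (P⇔Q a) (g a))

  ≡-cong-⇔ : {A : Set} {a a' b b' : A} → a ≡ a' → b ≡ b' → (a ≡ b) ⇔ (a' ≡ b')
  ≡-cong-⇔ refl refl = ⇔-id _

  ¬∀¬¬⇒¬¬∃¬ : {P : ℕ → Set} → ¬ (∀ N → ¬ ¬ P N) → ¬ ¬ Σ ℕ λ N → ¬ P N
  ¬∀¬¬⇒¬¬∃¬ ¬∀ k = ¬∀ λ N p → k (N , p)

  ¬¬-finite-choice : ∀ {K} {B : Set} (P : Fin K → B → Set) →
    (∀ i → ¬ ¬ Σ B (P i)) → ¬ ¬ Σ (Fin K → B) λ f → ∀ i → P i (f i)
  ¬¬-finite-choice {zero} P total k = k ((λ ()) , λ ())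
  ¬¬-finite-choice {suc K} P total k =
    total zero λ (b , p) → ¬¬-finite-choice (P ∘ suc) (total ∘ suc) λ (f , q) →
    k (b ∷ f , λ { zero → p ; (suc i) → q i })

  ¬¬-common-bound : (Q : ℕ → ℕ → Set) → (∀ {b N N'} → N ≤ N' → Q b N → Q b N') →
    (∀ b → ¬ ¬ Σ ℕ (Q b)) → ∀ L → ¬ ¬ Σ ℕ λ K → ∀ b → b < L → Q b K
  ¬¬-common-bound Q mono bound zero k = k (0 , λ _ ())
  ¬¬-common-bound Q mono bound (suc L) k =
    ¬¬-common-bound Q mono bound L λ (K , below) → bound L λ (N , at) →
    k (K ⊔ N , λ b b<1+L → [ mono (m≤m⊔n K N) ∘ below b , (λ { refl → mono (m≤n⊔m K N) at }) ]
                             (m≤n⇒m<n∨m≡n (ℕ.s≤s⁻¹ b<1+L)))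

  -- A total relation with functional converse has unbounded range: among the
  -- images of 0, …, N, pairwise distinct by the pigeonhole principle, one is ≥ N.
  unbounded-range : (R : ℕ → ℕ → Set) → (∀ y → ¬ ¬ Σ ℕ (R y)) →
    (∀ {u v z} → R u z → R v z → u ≡ v) → ∀ N → ¬ ¬ Σ ℕ λ z → N ≤ z × Σ ℕ λ y → R y z
  unbounded-range R total functional N k =
    ¬¬-finite-choice (R ∘ toℕ) (total ∘ toℕ) λ (f , Rf) →
    let f<N : ∀ i → f i < N
        f<N i = ≰⇒> λ N≤fi → k (f i , N≤fi , toℕ i , Rf i)
        (i , j , i<j , fi≡fj) = pigeonhole (n<1+n N) (λ i → fromℕ< (f<N i))
        same-image = subst (R (toℕ i)) (fromℕ<-injective (f i) (f j) (f<N i) (f<N j) fi≡fj) (Rf i)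
    in <⇒≢ i<j (toℕ-injective (functional same-image (Rf j)))

  renT≗subT : (f : Fin n → Fin m) (t : Term n) → renT f t ≡ subT (var ∘ f) t
  renT≗subT f (var i) = refl
  renT≗subT f 𝟎 = refl
  renT≗subT f (S t) = cong S (renT≗subT f t)
  renT≗subT f (s ⊕ t) = cong₂ _⊕_ (renT≗subT f s) (renT≗subT f t)
  renT≗subT f (s ⊗ t) = cong₂ _⊗_ (renT≗subT f s) (renT≗subT f t)

  EvalsTo : Sub n m → Env m → Env n → Set
  EvalsTo σ ρ ρ' = ∀ i → ⟦ σ i ⟧ᵗ ρ ≡ ρ' i

  ⟦⟧ᵗ-sub : (σ : Sub n m) (t : Term n) {ρ : Env m} {ρ' : Env n} →
    EvalsTo σ ρ ρ' → ⟦ subT σ t ⟧ᵗ ρ ≡ ⟦ t ⟧ᵗ ρ'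
  ⟦⟧ᵗ-sub σ (var i) h = h i
  ⟦⟧ᵗ-sub σ 𝟎 h = refl
  ⟦⟧ᵗ-sub σ (S t) h = cong suc (⟦⟧ᵗ-sub σ t h)
  ⟦⟧ᵗ-sub σ (s ⊕ t) h = cong₂ _+_ (⟦⟧ᵗ-sub σ s h) (⟦⟧ᵗ-sub σ t h)
  ⟦⟧ᵗ-sub σ (s ⊗ t) h = cong₂ _*_ (⟦⟧ᵗ-sub σ s h) (⟦⟧ᵗ-sub σ t h)

  ⟦⟧ᵗ-ren : (f : Fin n → Fin m) (t : Term n) {ρ : Env m} {ρ' : Env n} →
    (∀ i → ρ (f i) ≡ ρ' i) → ⟦ renT f t ⟧ᵗ ρ ≡ ⟦ t ⟧ᵗ ρ'
  ⟦⟧ᵗ-ren f t h = trans (cong (λ u → ⟦ u ⟧ᵗ _) (renT≗subT f t)) (⟦⟧ᵗ-sub (var ∘ f) t h)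

  ⟦⟧ᵗ-lift : ∀ k (v : Fin k → ℕ) (σ : Sub n m) {ρ ρ'} →
    EvalsTo σ ρ ρ' → EvalsTo (liftˢ k σ) (extend v ρ) (extend v ρ')
  ⟦⟧ᵗ-lift {n} {m} k v σ {ρ} {ρ'} h i = by-cases (splitAt k i)
    where
    by-cases : (s : Fin k ⊎ Fin n) →
      ⟦ [ (λ b → var (b ↑ˡ m)) , (λ j → renT (k ↑ʳ_) (σ j)) ] s ⟧ᵗ (extend v ρ) ≡ [ v , ρ' ] s
    by-cases (inj₁ b) = cong [ v , ρ ] (splitAt-↑ˡ k b m)
    by-cases (inj₂ j) = trans (⟦⟧ᵗ-ren (k ↑ʳ_) (σ j) (cong [ v , ρ ] ∘ splitAt-↑ʳ k m)) (h j)

  ⟦⟧-sub : (A : Formula n) (σ : Sub n m) {ρ : Env m} {ρ' : Env n} →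
    EvalsTo σ ρ ρ' → ⟦ sub σ A ⟧ ρ ⇔ ⟦ A ⟧ ρ'
  ⟦⟧-sub (s ≐ t) σ h = ≡-cong-⇔ (⟦⟧ᵗ-sub σ s h) (⟦⟧ᵗ-sub σ t h)
  ⟦⟧-sub ⊤' σ h = ⇔-id _
  ⟦⟧-sub ⊥' σ h = ⇔-id _
  ⟦⟧-sub (A ∧' B) σ h = ⟦⟧-sub A σ h ×-⇔ ⟦⟧-sub B σ h
  ⟦⟧-sub (A ∨' B) σ h = ¬¬-cong-⇔ (⟦⟧-sub A σ h ⊎-⇔ ⟦⟧-sub B σ h)
  ⟦⟧-sub (∃' A) σ h = ¬¬-cong-⇔ (Σ-⇔ (↠-id ℕ) λ {a} → ⟦⟧-sub A (liftˢ 1 σ) (⟦⟧ᵗ-lift 1 (λ _ → a) σ h))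
  ⟦⟧-sub (∀' k A B) σ h = Π-cong-⇔ λ v →
    →-cong-⇔ (⟦⟧-sub A (liftˢ k σ) (⟦⟧ᵗ-lift k v σ h)) (⟦⟧-sub B (liftˢ k σ) (⟦⟧ᵗ-lift k v σ h))

  ⟨,,⟩-⇔ : (C : Formula 3) (r s t : Term n) (ρ : Env n) →
    ⟦ _⟨_,_,_⟩ C r s t ⟧ ρ ⇔ ⟦ C ⟧ (⟦ r ⟧ᵗ ρ ∷ ⟦ s ⟧ᵗ ρ ∷ ⟦ t ⟧ᵗ ρ ∷ [])
  ⟨,,⟩-⇔ C r s t ρ = ⟦⟧-sub C _ λ { zero → refl ; (suc zero) → refl ; (suc (suc zero)) → refl }

  ⟨,⟩-⇔ : (D : Formula 2) (s t : Term n) (ρ : Env n) →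
    ⟦ _⟨_,_⟩ D s t ⟧ ρ ⇔ ⟦ D ⟧ (⟦ s ⟧ᵗ ρ ∷ ⟦ t ⟧ᵗ ρ ∷ [])
  ⟨,⟩-⇔ D s t ρ = ⟦⟧-sub D _ λ { zero → refl ; (suc zero) → refl }

  -- The structure ℕ∞

  data ℕ∞ : Set where
    fin : ℕ → ℕ∞
    ∞   : ℕ∞

  suc∞ : ℕ∞ → ℕ∞
  suc∞ (fin a) = fin (suc a)
  suc∞ ∞ = ∞

  _+∞_ : ℕ∞ → ℕ∞ → ℕ∞
  fin a +∞ fin b = fin (a + b)
  fin a +∞ ∞ = ∞
  ∞ +∞ _ = ∞

  _*∞_ : ℕ∞ → ℕ∞ → ℕ∞
  fin a *∞ fin b = fin (a * b)
  fin zero *∞ ∞ = fin 0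
  fin (suc a) *∞ ∞ = ∞
  ∞ *∞ fin zero = fin 0
  ∞ *∞ fin (suc b) = ∞
  ∞ *∞ ∞ = ∞

  infixl 6 _+∞_
  infixl 7 _*∞_

  _≟∞_ : (a b : ℕ∞) → Dec (a ≡ b)
  fin a ≟∞ fin b with a ℕ.≟ b
  ... | yes refl = yes refl
  ... | no a≢b = no λ { refl → a≢b refl }
  fin a ≟∞ ∞ = no λ ()
  ∞ ≟∞ fin b = no λ ()
  ∞ ≟∞ ∞ = yes refl

  suc∞≢0 : ∀ a → ¬ suc∞ a ≡ fin 0
  suc∞≢0 (fin a) ()
  suc∞≢0 ∞ ()

  suc∞-injective : ∀ a b → suc∞ a ≡ suc∞ b → a ≡ b
  suc∞-injective (fin a) (fin .a) refl = refl
  suc∞-injective ∞ ∞ refl = refl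

  +∞-identityʳ : ∀ a → a +∞ fin 0 ≡ a
  +∞-identityʳ (fin a) = cong fin (+-identityʳ a)
  +∞-identityʳ ∞ = refl

  +∞-suc : ∀ a b → a +∞ suc∞ b ≡ suc∞ (a +∞ b)
  +∞-suc (fin a) (fin b) = cong fin (+-suc a b)
  +∞-suc (fin a) ∞ = refl
  +∞-suc ∞ b = refl

  *∞-zeroˡ : ∀ b → fin 0 *∞ b ≡ fin 0
  *∞-zeroˡ (fin b) = refl
  *∞-zeroˡ ∞ = refl

  *∞-zeroʳ : ∀ a → a *∞ fin 0 ≡ fin 0
  *∞-zeroʳ (fin a) = cong fin (*-zeroʳ a)
  *∞-zeroʳ ∞ = refl

  *∞-suc : ∀ a b → a *∞ suc∞ b ≡ a *∞ b +∞ a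
  *∞-suc (fin a) (fin b) = cong fin (trans (*-suc a b) (+-comm a (a * b)))
  *∞-suc (fin zero) ∞ = refl
  *∞-suc (fin (suc a)) ∞ = refl
  *∞-suc ∞ (fin zero) = refl
  *∞-suc ∞ (fin (suc b)) = refl
  *∞-suc ∞ ∞ = refl

  Env∞ : ℕ → Set
  Env∞ n = Fin n → ℕ∞

  ⟦_⟧ᵗ∞ : Term n → Env∞ n → ℕ∞
  ⟦ var i ⟧ᵗ∞ ρ = ρ i
  ⟦ 𝟎 ⟧ᵗ∞ ρ = fin 0
  ⟦ S t ⟧ᵗ∞ ρ = suc∞ (⟦ t ⟧ᵗ∞ ρ)
  ⟦ s ⊕ t ⟧ᵗ∞ ρ = ⟦ s ⟧ᵗ∞ ρ +∞ ⟦ t ⟧ᵗ∞ ρ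
  ⟦ s ⊗ t ⟧ᵗ∞ ρ = ⟦ s ⟧ᵗ∞ ρ *∞ ⟦ t ⟧ᵗ∞ ρ

  ⟦_⟧∞ : Formula n → Env∞ n → Set
  ⟦ s ≐ t ⟧∞ ρ = ⟦ s ⟧ᵗ∞ ρ ≡ ⟦ t ⟧ᵗ∞ ρ
  ⟦ ⊤' ⟧∞ ρ = ⊤
  ⟦ ⊥' ⟧∞ ρ = ⊥
  ⟦ A ∧' B ⟧∞ ρ = ⟦ A ⟧∞ ρ × ⟦ B ⟧∞ ρ
  ⟦ A ∨' B ⟧∞ ρ = ¬ ¬ (⟦ A ⟧∞ ρ ⊎ ⟦ B ⟧∞ ρ)
  ⟦ ∃' A ⟧∞ ρ = ¬ ¬ Σ ℕ∞ λ a → ⟦ A ⟧∞ (a ∷ ρ)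
  ⟦ ∀' k A B ⟧∞ ρ = ⊤

  ⟦⟧∞-stable : (A : Formula n) (ρ : Env∞ n) → Stable (⟦ A ⟧∞ ρ)
  ⟦⟧∞-stable (s ≐ t) ρ = decidable-stable (⟦ s ⟧ᵗ∞ ρ ≟∞ ⟦ t ⟧ᵗ∞ ρ)
  ⟦⟧∞-stable ⊤' ρ _ = tt
  ⟦⟧∞-stable ⊥' ρ ¬¬⊥ = ¬¬⊥ id
  ⟦⟧∞-stable (A ∧' B) ρ ab = ⟦⟧∞-stable A ρ (¬¬-map proj₁ ab) , ⟦⟧∞-stable B ρ (¬¬-map proj₂ ab)
  ⟦⟧∞-stable (A ∨' B) ρ = negated-stable
  ⟦⟧∞-stable (∃' A) ρ = negated-stable
  ⟦⟧∞-stable (∀' k A B) ρ _ = tt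

  EvalsTo∞ : Sub n m → Env∞ m → Env∞ n → Set
  EvalsTo∞ σ ρ ρ' = ∀ i → ⟦ σ i ⟧ᵗ∞ ρ ≡ ρ' i

  ⟦⟧ᵗ∞-sub : (σ : Sub n m) (t : Term n) {ρ : Env∞ m} {ρ' : Env∞ n} →
    EvalsTo∞ σ ρ ρ' → ⟦ subT σ t ⟧ᵗ∞ ρ ≡ ⟦ t ⟧ᵗ∞ ρ'
  ⟦⟧ᵗ∞-sub σ (var i) h = h i
  ⟦⟧ᵗ∞-sub σ 𝟎 h = refl
  ⟦⟧ᵗ∞-sub σ (S t) h = cong suc∞ (⟦⟧ᵗ∞-sub σ t h)
  ⟦⟧ᵗ∞-sub σ (s ⊕ t) h = cong₂ _+∞_ (⟦⟧ᵗ∞-sub σ s h) (⟦⟧ᵗ∞-sub σ t h)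
  ⟦⟧ᵗ∞-sub σ (s ⊗ t) h = cong₂ _*∞_ (⟦⟧ᵗ∞-sub σ s h) (⟦⟧ᵗ∞-sub σ t h)

  ⟦⟧ᵗ∞-lift : (σ : Sub n m) {ρ : Env∞ m} {ρ' : Env∞ n} →
    EvalsTo∞ σ ρ ρ' → ∀ a → EvalsTo∞ (liftˢ 1 σ) (a ∷ ρ) (a ∷ ρ')
  ⟦⟧ᵗ∞-lift σ h a zero = refl
  ⟦⟧ᵗ∞-lift σ h a (suc i) =
    trans (trans (cong (λ u → ⟦ u ⟧ᵗ∞ _) (renT≗subT suc (σ i))) (⟦⟧ᵗ∞-sub (var ∘ suc) (σ i) λ _ → refl)) (h i)

  ⟦⟧∞-sub : (A : Formula n) (σ : Sub n m) {ρ : Env∞ m} {ρ' : Env∞ n} →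
    EvalsTo∞ σ ρ ρ' → ⟦ sub σ A ⟧∞ ρ ⇔ ⟦ A ⟧∞ ρ'
  ⟦⟧∞-sub (s ≐ t) σ h = ≡-cong-⇔ (⟦⟧ᵗ∞-sub σ s h) (⟦⟧ᵗ∞-sub σ t h)
  ⟦⟧∞-sub ⊤' σ h = ⇔-id _
  ⟦⟧∞-sub ⊥' σ h = ⇔-id _
  ⟦⟧∞-sub (A ∧' B) σ h = ⟦⟧∞-sub A σ h ×-⇔ ⟦⟧∞-sub B σ h
  ⟦⟧∞-sub (A ∨' B) σ h = ¬¬-cong-⇔ (⟦⟧∞-sub A σ h ⊎-⇔ ⟦⟧∞-sub B σ h)
  ⟦⟧∞-sub (∃' A) σ h = ¬¬-cong-⇔ (Σ-⇔ (↠-id ℕ∞) λ {a} → ⟦⟧∞-sub A (liftˢ 1 σ) (⟦⟧ᵗ∞-lift σ h a))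
  ⟦⟧∞-sub (∀' k A B) σ h = ⇔-id _

  ⟦⟧∞-cong : (A : Formula n) {ρ ρ' : Env∞ n} → (∀ i → ρ i ≡ ρ' i) → ⟦ A ⟧∞ ρ → ⟦ A ⟧∞ ρ'
  ⟦⟧∞-cong A h = to (⟦⟧∞-sub A var h) ∘ from (⟦⟧∞-sub A var λ _ → refl)

  ⟦⟧∞-wk : (A : Formula n) (ρ : Env∞ (suc n)) → ⟦ wk A ⟧∞ ρ ⇔ ⟦ A ⟧∞ (tail ρ)
  ⟦⟧∞-wk A ρ = ⟦⟧∞-sub A (var ∘ suc) λ _ → refl

  ⟨,⟩-⇔∞ : (D : Formula 2) (s t : Term n) (ρ : Env∞ n) →
    ⟦ _⟨_,_⟩ D s t ⟧∞ ρ ⇔ ⟦ D ⟧∞ (⟦ s ⟧ᵗ∞ ρ ∷ ⟦ t ⟧ᵗ∞ ρ ∷ [])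
  ⟨,⟩-⇔∞ D s t ρ = ⟦⟧∞-sub D _ λ { zero → refl ; (suc zero) → refl }

  ⟦⟧ᵗ∞-fin : (t : Term n) {ρ : Env n} {ρ∞ : Env∞ n} →
    (∀ i → ρ∞ i ≡ fin (ρ i)) → ⟦ t ⟧ᵗ∞ ρ∞ ≡ fin (⟦ t ⟧ᵗ ρ)
  ⟦⟧ᵗ∞-fin (var i) h = h i
  ⟦⟧ᵗ∞-fin 𝟎 h = refl
  ⟦⟧ᵗ∞-fin (S t) h = cong suc∞ (⟦⟧ᵗ∞-fin t h)
  ⟦⟧ᵗ∞-fin (s ⊕ t) h = cong₂ _+∞_ (⟦⟧ᵗ∞-fin s h) (⟦⟧ᵗ∞-fin t h)
  ⟦⟧ᵗ∞-fin (s ⊗ t) h = cong₂ _*∞_ (⟦⟧ᵗ∞-fin s h) (⟦⟧ᵗ∞-fin t h)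

  -- Only this direction holds: ∀' is true in ℕ∞ whatever its truth value in ℕ.
  ⟦⟧⇒⟦⟧∞ : (A : Formula n) {ρ : Env n} {ρ∞ : Env∞ n} →
    (∀ i → ρ∞ i ≡ fin (ρ i)) → ⟦ A ⟧ ρ → ⟦ A ⟧∞ ρ∞
  ⟦⟧⇒⟦⟧∞ (s ≐ t) h e = trans (⟦⟧ᵗ∞-fin s h) (trans (cong fin e) (sym (⟦⟧ᵗ∞-fin t h)))
  ⟦⟧⇒⟦⟧∞ ⊤' h _ = tt
  ⟦⟧⇒⟦⟧∞ ⊥' h ()
  ⟦⟧⇒⟦⟧∞ (A ∧' B) h (a , b) = ⟦⟧⇒⟦⟧∞ A h a , ⟦⟧⇒⟦⟧∞ B h b
  ⟦⟧⇒⟦⟧∞ (A ∨' B) h = ¬¬-map [ inj₁ ∘ ⟦⟧⇒⟦⟧∞ A h , inj₂ ∘ ⟦⟧⇒⟦⟧∞ B h ]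
  ⟦⟧⇒⟦⟧∞ (∃' A) h = ¬¬-map λ (a , s) → fin a , ⟦⟧⇒⟦⟧∞ A (λ { zero → refl ; (suc i) → h i }) s
  ⟦⟧⇒⟦⟧∞ (∀' k A B) h _ = tt

  -- Topology of ℕ∞

  infix 4 _≤∞_

  _≤∞_ : ℕ → ℕ∞ → Set
  N ≤∞ fin b = N ≤ b
  N ≤∞ ∞ = ⊤

  -- Near N a b: b lies in the N-th basic neighbourhood of a.
  data Near (N : ℕ) : ℕ∞ → ℕ∞ → Set where
    fin-near : ∀ {a b} → b ≡ fin a → Near N (fin a) b
    ∞-near   : ∀ {b} → N ≤∞ b → Near N ∞ b

  NearEnv : ℕ → Env∞ n → Env∞ n → Set
  NearEnv N σ τ = ∀ i → Near N (σ i) (τ i)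

  ≤∞-weaken : ∀ {N N'} b → N ≤ N' → N' ≤∞ b → N ≤∞ b
  ≤∞-weaken (fin b) N≤N' N'≤b = ≤-trans N≤N' N'≤b
  ≤∞-weaken ∞ _ _ = tt

  Near-weaken : ∀ {N N' a b} → N ≤ N' → Near N' a b → Near N a b
  Near-weaken _ (fin-near b≡a) = fin-near b≡a
  Near-weaken N≤N' (∞-near {b} N'≤b) = ∞-near (≤∞-weaken b N≤N' N'≤b)

  NearEnv-weaken : ∀ {N N'} {σ τ : Env∞ n} → N ≤ N' → NearEnv N' σ τ → NearEnv N σ τ
  NearEnv-weaken N≤N' near = Near-weaken N≤N' ∘ near

  Near-refl : ∀ N a → Near N a a
  Near-refl N (fin a) = fin-near refl
  Near-refl N ∞ = ∞-near tt

  NearEnv-∷ : ∀ {N a b} {σ τ : Env∞ n} → Near N a b → NearEnv N σ τ → NearEnv N (a ∷ σ) (b ∷ τ)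
  NearEnv-∷ a~b σ~τ zero = a~b
  NearEnv-∷ a~b σ~τ (suc i) = σ~τ i

  Near-separated : ∀ {a b} → ¬ a ≡ b → Σ ℕ λ N → ∀ {c} → Near N a c → Near N b c → ⊥
  Near-separated {fin a} {fin b} a≢b = 0 , λ { (fin-near c≡a) (fin-near c≡b) → a≢b (trans (sym c≡a) c≡b) }
  Near-separated {fin a} {∞} _ = suc a , λ { (fin-near refl) (∞-near a<a) → <-irrefl refl a<a }
  Near-separated {∞} {fin b} _ = suc b , λ { (∞-near b<b) (fin-near refl) → <-irrefl refl b<b }
  Near-separated {∞} {∞} ∞≢∞ = ⊥-elim (∞≢∞ refl)

  ≤∞-+ˡ : ∀ {N} b d → N ≤∞ b → N ≤∞ b +∞ d
  ≤∞-+ˡ (fin b) (fin d) N≤b = ≤-trans N≤b (m≤m+n b d)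
  ≤∞-+ˡ (fin b) ∞ _ = tt
  ≤∞-+ˡ ∞ d _ = tt

  ≤∞-+ʳ : ∀ {N} b d → N ≤∞ d → N ≤∞ b +∞ d
  ≤∞-+ʳ (fin b) (fin d) N≤d = ≤-trans N≤d (m≤n+m d b)
  ≤∞-+ʳ (fin b) ∞ _ = tt
  ≤∞-+ʳ ∞ d _ = tt

  ≤∞-*ˡ : ∀ {N} b d → N ≤∞ b → 1 ≤∞ d → N ≤∞ b *∞ d
  ≤∞-*ˡ (fin b) (fin (suc d)) N≤b _ = ≤-trans N≤b (m≤m*n b (suc d))
  ≤∞-*ˡ (fin zero) ∞ N≤0 _ = N≤0
  ≤∞-*ˡ (fin (suc b)) ∞ _ _ = tt
  ≤∞-*ˡ ∞ (fin (suc d)) _ _ = tt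
  ≤∞-*ˡ ∞ ∞ _ _ = tt

  ≤∞-*ʳ : ∀ {N} b d → 1 ≤∞ b → N ≤∞ d → N ≤∞ b *∞ d
  ≤∞-*ʳ (fin (suc b)) (fin d) _ N≤d = ≤-trans N≤d (m≤m+n d (b * d))
  ≤∞-*ʳ (fin (suc b)) ∞ _ _ = tt
  ≤∞-*ʳ ∞ (fin zero) _ N≤0 = N≤0
  ≤∞-*ʳ ∞ (fin (suc d)) _ _ = tt
  ≤∞-*ʳ ∞ ∞ _ _ = tt

  suc∞-continuous : ∀ {N a b} → Near N a b → Near N (suc∞ a) (suc∞ b)
  suc∞-continuous (fin-near refl) = fin-near refl
  suc∞-continuous (∞-near {fin b} N≤b) = ∞-near (≤-trans N≤b (n≤1+n b))
  suc∞-continuous (∞-near {∞} _) = ∞-near tt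

  +∞-continuous : ∀ {N a b c d} → Near N a b → Near N c d → Near N (a +∞ c) (b +∞ d)
  +∞-continuous (fin-near refl) (fin-near refl) = fin-near refl
  +∞-continuous (fin-near {b = b} refl) (∞-near {d} N≤d) = ∞-near (≤∞-+ʳ b d N≤d)
  +∞-continuous {d = d} (∞-near {b} N≤b) _ = ∞-near (≤∞-+ˡ b d N≤b)

  -- Multiplication needs the finer modulus suc N: neighbours of ∞ must be nonzero.
  *∞-continuous : ∀ {N a b c d} → Near (suc N) a b → Near (suc N) c d → Near N (a *∞ c) (b *∞ d)
  *∞-continuous (fin-near refl) (fin-near refl) = fin-near refl
  *∞-continuous (fin-near {zero} refl) (∞-near {d} _) = fin-near (*∞-zeroˡ d)
  *∞-continuous {N} (fin-near {suc a} refl) (∞-near {d} N<d) =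
    ∞-near (≤∞-*ʳ (fin (suc a)) d (s≤s z≤n) (≤∞-weaken d (n≤1+n N) N<d))
  *∞-continuous (∞-near {b} _) (fin-near {zero} refl) = fin-near (*∞-zeroʳ b)
  *∞-continuous {N} (∞-near {b} N<b) (fin-near {suc c} refl) =
    ∞-near (≤∞-*ˡ b (fin (suc c)) (≤∞-weaken b (n≤1+n N) N<b) (s≤s z≤n))
  *∞-continuous {N} (∞-near {b} N<b) (∞-near {d} N<d) =
    ∞-near (≤∞-*ˡ b d (≤∞-weaken b (n≤1+n N) N<b) (≤∞-weaken d (s≤s z≤n) N<d))

  ⟦⟧ᵗ∞-continuous : (t : Term n) (σ : Env∞ n) (N : ℕ) →
    Σ ℕ λ N' → ∀ τ → NearEnv N' σ τ → Near N (⟦ t ⟧ᵗ∞ σ) (⟦ t ⟧ᵗ∞ τ)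
  ⟦⟧ᵗ∞-continuous (var i) σ N = N , λ τ near → near i
  ⟦⟧ᵗ∞-continuous 𝟎 σ N = 0 , λ τ _ → fin-near refl
  ⟦⟧ᵗ∞-continuous (S t) σ N =
    let (N' , t-cont) = ⟦⟧ᵗ∞-continuous t σ N
    in N' , λ τ near → suc∞-continuous (t-cont τ near)
  ⟦⟧ᵗ∞-continuous (s ⊕ t) σ N =
    let (N₁ , s-cont) = ⟦⟧ᵗ∞-continuous s σ N
        (N₂ , t-cont) = ⟦⟧ᵗ∞-continuous t σ N
    in N₁ ⊔ N₂ , λ τ near → +∞-continuous
         (s-cont τ (NearEnv-weaken (m≤m⊔n N₁ N₂) near)) (t-cont τ (NearEnv-weaken (m≤n⊔m N₁ N₂) near))
  ⟦⟧ᵗ∞-continuous (s ⊗ t) σ N =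
    let (N₁ , s-cont) = ⟦⟧ᵗ∞-continuous s σ (suc N)
        (N₂ , t-cont) = ⟦⟧ᵗ∞-continuous t σ (suc N)
    in N₁ ⊔ N₂ , λ τ near → *∞-continuous
         (s-cont τ (NearEnv-weaken (m≤m⊔n N₁ N₂) near)) (t-cont τ (NearEnv-weaken (m≤n⊔m N₁ N₂) near))

  -- Closedness of the sets defined by formulas

  SatisfiedNear : Formula n → ℕ → Env∞ n → Set
  SatisfiedNear {n} A N σ = Σ (Env∞ n) λ τ → NearEnv N σ τ × ⟦ A ⟧∞ τ

  SatisfiedNear-weaken : ∀ (A : Formula n) {N N' σ} → N ≤ N' → SatisfiedNear A N' σ → SatisfiedNear A N σ
  SatisfiedNear-weaken A N≤N' (τ , near , a) = τ , NearEnv-weaken N≤N' near , a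

  IsClosedAt : Formula n → Env∞ n → Set
  IsClosedAt A σ = (∀ N → ¬ ¬ SatisfiedNear A N σ) → ⟦ A ⟧∞ σ

  complement-open : ∀ (A : Formula n) {σ} → IsClosedAt A σ → ¬ ⟦ A ⟧∞ σ → ¬ ¬ Σ ℕ λ N → ¬ SatisfiedNear A N σ
  complement-open A closed ¬A = ¬∀¬¬⇒¬¬∃¬ (¬A ∘ closed)

  closed-≐ : ∀ (s t : Term n) σ → IsClosedAt (s ≐ t) σ
  closed-≐ s t σ near = decidable-stable (⟦ s ⟧ᵗ∞ σ ≟∞ ⟦ t ⟧ᵗ∞ σ) λ s≢t →
    let (N , apart) = Near-separated s≢t
        (N₁ , s-cont) = ⟦⟧ᵗ∞-continuous s σ N
        (N₂ , t-cont) = ⟦⟧ᵗ∞-continuous t σ N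
    in near (N₁ ⊔ N₂) λ (τ , σ~τ , s≡t) →
         apart (s-cont τ (NearEnv-weaken (m≤m⊔n N₁ N₂) σ~τ))
           (subst (Near N (⟦ t ⟧ᵗ∞ σ)) (sym s≡t) (t-cont τ (NearEnv-weaken (m≤n⊔m N₁ N₂) σ~τ)))

  closed-∧ : ∀ (A B : Formula n) {σ} → IsClosedAt A σ → IsClosedAt B σ → IsClosedAt (A ∧' B) σ
  closed-∧ A B closedA closedB near =
    closedA (λ N → ¬¬-map (λ (τ , σ~τ , a , _) → τ , σ~τ , a) (near N)) ,
    closedB (λ N → ¬¬-map (λ (τ , σ~τ , _ , b) → τ , σ~τ , b) (near N))

  closed-∨ : ∀ (A B : Formula n) {σ} → IsClosedAt A σ → IsClosedAt B σ → IsClosedAt (A ∨' B) σ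
  closed-∨ A B closedA closedB near ¬A∨B =
    complement-open A closedA (¬A∨B ∘ inj₁) λ (N₁ , farA) →
    complement-open B closedB (¬A∨B ∘ inj₂) λ (N₂ , farB) →
    near (N₁ ⊔ N₂) λ (τ , σ~τ , a∨b) → a∨b
      [ (λ a → farA (SatisfiedNear-weaken A (m≤m⊔n N₁ N₂) (τ , σ~τ , a)))
      , (λ b → farB (SatisfiedNear-weaken B (m≤n⊔m N₁ N₂) (τ , σ~τ , b))) ]

  -- If ∃B fails at σ, then B fails near every a ∷ σ; the neighbourhood of ∞ ∷ σ
  -- covers all but finitely many a, and finitely many neighbourhoods have a
  -- common refinement.
  closed-∃ : ∀ (B : Formula (suc n)) {σ} → (∀ a → IsClosedAt B (a ∷ σ)) → IsClosedAt (∃' B) σ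
  closed-∃ B {σ} closedB near ¬∃B =
    complement-open B (closedB ∞) (¬∃B ∘ (∞ ,_)) λ (N∞ , far∞) →
    ¬¬-common-bound (λ b N → ¬ SatisfiedNear B N (fin b ∷ σ))
      (λ N≤N' far → far ∘ SatisfiedNear-weaken B N≤N')
      (λ b → complement-open B (closedB (fin b)) (¬∃B ∘ (fin b ,_))) N∞ λ (K , far) →
    near (K ⊔ N∞) λ (τ , σ~τ , ∃b) → ∃b λ (a , b) → witness-near a σ~τ b far∞ far
    where
    witness-near : ∀ {K N∞ τ} a → NearEnv (K ⊔ N∞) σ τ → ⟦ B ⟧∞ (a ∷ τ) →
      ¬ SatisfiedNear B N∞ (∞ ∷ σ) → (∀ c → c < N∞ → ¬ SatisfiedNear B K (fin c ∷ σ)) → ⊥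
    witness-near {K} {N∞} ∞ σ~τ b far∞ far =
      far∞ (_ , NearEnv-∷ (∞-near tt) (NearEnv-weaken (m≤n⊔m K N∞) σ~τ) , b)
    witness-near {K} {N∞} (fin c) σ~τ b far∞ far with c <? N∞
    ... | yes c<N∞ = far c c<N∞ (_ , NearEnv-∷ (fin-near refl) (NearEnv-weaken (m≤m⊔n K N∞) σ~τ) , b)
    ... | no c≮N∞ = far∞ (_ , NearEnv-∷ (∞-near (≮⇒≥ c≮N∞)) (NearEnv-weaken (m≤n⊔m K N∞) σ~τ) , b)

  ⟦⟧∞-closed : (A : Formula n) (σ : Env∞ n) → IsClosedAt A σ
  ⟦⟧∞-closed (s ≐ t) σ = closed-≐ s t σ
  ⟦⟧∞-closed ⊤' σ _ = tt
  ⟦⟧∞-closed ⊥' σ near = ⊥-elim (near 0 λ { (_ , _ , ()) })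
  ⟦⟧∞-closed (A ∧' B) σ = closed-∧ A B (⟦⟧∞-closed A σ) (⟦⟧∞-closed B σ)
  ⟦⟧∞-closed (A ∨' B) σ = closed-∨ A B (⟦⟧∞-closed A σ) (⟦⟧∞-closed B σ)
  ⟦⟧∞-closed (∃' B) σ = closed-∃ B λ a → ⟦⟧∞-closed B (a ∷ σ)
  ⟦⟧∞-closed (∀' k A B) σ _ = tt

  ⟦⟧∞-at-∞ : (A : Formula (suc n)) (ρ : Env∞ n) →
    (∀ N → ¬ ¬ Σ ℕ λ z → N ≤ z × ⟦ A ⟧∞ (fin z ∷ ρ)) → ⟦ A ⟧∞ (∞ ∷ ρ)
  ⟦⟧∞-at-∞ A ρ large = ⟦⟧∞-closed A (∞ ∷ ρ) λ N →
    ¬¬-map (λ (z , N≤z , a) → fin z ∷ ρ , NearEnv-∷ (∞-near N≤z) (Near-refl N ∘ ρ) , a) (large N)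

  -- Soundness of BA in ℕ∞

  _[_≔_] : Env∞ n → Fin n → ℕ∞ → Env∞ n
  (ρ [ x ≔ a ]) i with x ≟ i
  ... | yes _ = a
  ... | no _ = ρ i

  single-eval : (x : Fin n) (t : Term n) (ρ : Env∞ n) → EvalsTo∞ (single x t) ρ (ρ [ x ≔ ⟦ t ⟧ᵗ∞ ρ ])
  single-eval x t ρ i with x ≟ i
  ... | yes _ = refl
  ... | no _ = refl

  ≔-self : ∀ (ρ : Env∞ n) x {a} → ρ x ≡ a → ∀ i → (ρ [ x ≔ a ]) i ≡ ρ i
  ≔-self ρ x ρx≡a i with x ≟ i
  ... | yes refl = sym ρx≡a
  ... | no _ = refl

  ≔-lookup : (ρ : Env∞ n) (x : Fin n) (a : ℕ∞) → (ρ [ x ≔ a ]) x ≡ a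
  ≔-lookup ρ x a with x ≟ x
  ... | yes _ = refl
  ... | no x≢x = ⊥-elim (x≢x refl)

  ≔-other : ∀ (ρ : Env∞ n) {x i} a → ¬ x ≡ i → (ρ [ x ≔ a ]) i ≡ ρ i
  ≔-other ρ {x} {i} a x≢i with x ≟ i
  ... | yes x≡i = ⊥-elim (x≢i x≡i)
  ... | no _ = refl

  ≔-≔ : (ρ : Env∞ n) (x : Fin n) (a b : ℕ∞) → ∀ i → ((ρ [ x ≔ a ]) [ x ≔ b ]) i ≡ (ρ [ x ≔ b ]) i
  ≔-≔ ρ x a b i with x ≟ i
  ... | yes _ = refl
  ... | no x≢i = ≔-other ρ a x≢i

  ≔-near : ∀ N (ρ : Env∞ n) x → NearEnv N (ρ [ x ≔ ∞ ]) (ρ [ x ≔ fin N ])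
  ≔-near N ρ x i with x ≟ i
  ... | yes _ = ∞-near ≤-refl
  ... | no _ = Near-refl N (ρ i)

  ℕ∞-induction : (A : Formula n) (ρ : Env∞ n) (x : Fin n) →
    ⟦ A ⟧∞ (ρ [ x ≔ fin 0 ]) →
    (∀ k → ⟦ A ⟧∞ (ρ [ x ≔ fin k ]) → ⟦ A ⟧∞ (ρ [ x ≔ fin (suc k) ])) →
    ∀ a → ⟦ A ⟧∞ (ρ [ x ≔ a ])
  ℕ∞-induction A ρ x base step = at
    where
    at-fin : ∀ k → ⟦ A ⟧∞ (ρ [ x ≔ fin k ])
    at-fin zero = base
    at-fin (suc k) = step k (at-fin k)
    at : ∀ a → ⟦ A ⟧∞ (ρ [ x ≔ a ])
    at (fin k) = at-fin k
    at ∞ = ⟦⟧∞-closed A (ρ [ x ≔ ∞ ]) λ N k → k (ρ [ x ≔ fin N ] , ≔-near N ρ x , at-fin N)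

  -- No rule eliminates ∀' (there is no modus ponens), so reading ∀' as true is sound.
  soundness : {A B : Formula n} → BA⊢ A ⇒ B → ∀ ρ → ⟦ A ⟧∞ ρ → ⟦ B ⟧∞ ρ
  soundness ax-id ρ a = a
  soundness ax-⊤ ρ _ = tt
  soundness ax-⊥ ρ ()
  soundness ax-dist ρ (a , b∨c) = ¬¬-map [ inj₁ ∘ (a ,_) , inj₂ ∘ (a ,_) ] b∨c
  soundness (ax-frob {A = A}) ρ (a , ∃b) = ¬¬-map (λ (x , b) → x , from (⟦⟧∞-wk A (x ∷ ρ)) a , b) ∃b
  soundness (ax-refl x) ρ _ = refl
  soundness (ax-eq x y {A} _) ρ (ρx≡ρy , a) =
    from (⟦⟧∞-sub A (single x (var y)) λ i → trans (single-eval x (var y) ρ i) (≔-self ρ x ρx≡ρy i)) a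
  soundness ax-trans ρ _ = tt
  soundness ax-conj ρ _ = tt
  soundness ax-disj ρ _ = tt
  soundness (ax-inst ts) ρ _ = tt
  soundness (ax-rebind f _ _) ρ _ = tt
  soundness ax-∃ ρ _ = tt
  soundness (r-trans d e) ρ = soundness e ρ ∘ soundness d ρ
  soundness (r-∧I d e) ρ a = soundness d ρ a , soundness e ρ a
  soundness (r-∧E₁ d) ρ = proj₁ ∘ soundness d ρ
  soundness (r-∧E₂ d) ρ = proj₂ ∘ soundness d ρ
  soundness (r-∨E {A = A} d e) ρ b∨c = ⟦⟧∞-stable A ρ (¬¬-map [ soundness d ρ , soundness e ρ ] b∨c)
  soundness (r-∨I₁ d) ρ b = soundness d ρ λ k → k (inj₁ b)
  soundness (r-∨I₂ d) ρ c = soundness d ρ λ k → k (inj₂ c)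
  soundness (r-∃E {A = A} d) ρ ∃b =
    ⟦⟧∞-stable A ρ (¬¬-map (λ (x , b) → to (⟦⟧∞-wk A (x ∷ ρ)) (soundness d (x ∷ ρ) b)) ∃b)
  soundness (r-∃I {A = A} {B} d) ρ b =
    from (⟦⟧∞-wk A ρ) (soundness d (tail ρ) λ k → k (head ρ , ⟦⟧∞-cong B (λ { zero → refl ; (suc i) → refl }) b))
  soundness (r-→I d) ρ _ = tt
  soundness (ar-S0 x) ρ = suc∞≢0 (ρ x)
  soundness (ar-SS x y) ρ = suc∞-injective (ρ x) (ρ y)
  soundness (ar-+0 x) ρ _ = +∞-identityʳ (ρ x)
  soundness (ar-+S x y) ρ _ = +∞-suc (ρ x) (ρ y)
  soundness (ar-·0 x) ρ _ = *∞-zeroʳ (ρ x)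
  soundness (ar-·S x y) ρ _ = *∞-suc (ρ x) (ρ y)
  soundness (ar-ind A) ρ _ = tt
  soundness (r-subst {A = A} {B} σ d) ρ a =
    from (⟦⟧∞-sub B σ λ _ → refl) (soundness d _ (to (⟦⟧∞-sub A σ λ _ → refl) a))
  soundness (r-ind x A d) ρ a₀ = ⟦⟧∞-cong A (≔-self ρ x refl) (ℕ∞-induction A ρ x base step (ρ x))
    where
    base : ⟦ A ⟧∞ (ρ [ x ≔ fin 0 ])
    base = to (⟦⟧∞-sub A (single x 𝟎) (single-eval x 𝟎 ρ)) a₀
    step : ∀ k → ⟦ A ⟧∞ (ρ [ x ≔ fin k ]) → ⟦ A ⟧∞ (ρ [ x ≔ fin (suc k) ])
    step k a = to (⟦⟧∞-sub A (single x (S (var x))) evals) (soundness d _ a)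
      where
      evals : EvalsTo∞ (single x (S (var x))) (ρ [ x ≔ fin k ]) (ρ [ x ≔ fin (suc k) ])
      evals i = trans (single-eval x (S (var x)) _ i)
        (trans (cong (λ b → ((ρ [ x ≔ fin k ]) [ x ≔ suc∞ b ]) i) (≔-lookup ρ x (fin k)))
               (≔-≔ ρ x (fin k) (fin (suc k)) i))

  ⟦⟧∞-at-∞-on-injective-image : (C : Formula 3) (D : Formula 2) →
    (∀ x y → ¬ ¬ Σ ℕ λ z → ⟦ C ⟧ (x ∷ y ∷ z ∷ [])) →
    (∀ x {u v z} → ⟦ C ⟧ (x ∷ u ∷ z ∷ []) → ⟦ C ⟧ (x ∷ v ∷ z ∷ []) → u ≡ v) →
    (∀ x y z → ⟦ C ⟧ (x ∷ y ∷ z ∷ []) → ⟦ D ⟧ (z ∷ x ∷ [])) →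
    ∀ x → ⟦ D ⟧∞ (∞ ∷ fin x ∷ [])
  ⟦⟧∞-at-∞-on-injective-image C D total functional C⇒D x = ⟦⟧∞-at-∞ D (fin x ∷ []) λ N →
    ¬¬-map (λ (z , N≤z , y , c) → z , N≤z , ⟦⟧⇒⟦⟧∞ D (λ { zero → refl ; (suc zero) → refl }) (C⇒D x y z c))
      (unbounded-range (λ y z → ⟦ C ⟧ (x ∷ y ∷ z ∷ [])) (total x) (functional x) N)

corollary3p19 : ¬ (Σ (Formula 3) λ C → Σ (Formula 2) λ D →
      (ℕ⊨ ∀' 2 ⊤' (∃' (C ⟨ var (# 1) , var (# 2) , var (# 0) ⟩)))
    × (ℕ⊨ ∀' 4 ((C ⟨ var (# 0) , var (# 1) , var (# 3) ⟩) ∧' (C ⟨ var (# 0) , var (# 2) , var (# 3) ⟩))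
                (var (# 1) ≐ var (# 2)))
    × (ℕ⊨ ∀' 3 (C ⟨ var (# 0) , var (# 1) , var (# 2) ⟩) (D ⟨ var (# 2) , var (# 0) ⟩))
    × (BA⊢_ {1} (∃' (D ⟨ var (# 1) , var (# 0) ⟩)))
    × (BA⊢_⇒_ {3} ((D ⟨ var (# 0) , var (# 1) ⟩) ∧' (D ⟨ var (# 0) , var (# 2) ⟩)) (var (# 1) ≐ var (# 2))))
corollary3p19 (C Σ., D Σ., total Σ., functional Σ., C⇒D Σ., _ Σ., D-functional) =
  suc∞≢0 (fin 0) (sym (soundness D-functional (∞ ∷ fin 0 ∷ fin 1 ∷ [])
    (from (⟨,⟩-⇔∞ D _ _ _) (D-at-∞ 0) Σ., from (⟨,⟩-⇔∞ D _ _ _) (D-at-∞ 1))))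
  where
  D-at-∞ : ∀ x → ⟦ D ⟧∞ (∞ ∷ fin x ∷ [])
  D-at-∞ = ⟦⟧∞-at-∞-on-injective-image C D
    (λ x y → ¬¬-map (Σ.map₂ (to (⟨,,⟩-⇔ C _ _ _ _))) (total (x ∷ y ∷ []) tt))
    (λ x cu cv → functional (x ∷ _ ∷ _ ∷ _ ∷ []) (from (⟨,,⟩-⇔ C _ _ _ _) cu Σ., from (⟨,,⟩-⇔ C _ _ _ _) cv))
    (λ x y z c → to (⟨,⟩-⇔ D _ _ _) (C⇒D (x ∷ y ∷ z ∷ []) (from (⟨,,⟩-⇔ C _ _ _ _) c)))
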